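{- Let $p\geq k\geq 2$ be integers and let $G$ be the complete bipartite graph $K_{p,p}$. If $p$ is even, then $G$ is a $(\lfloor p/2\rfloor-1)$HLPM-graph; if $p$ is odd, then $G$ is a $\lfloor p/2\rfloor$-Hamiltonian-like decomposable graph. In either case $\gamma_{\times k,t}(G_I)=2pk$.
   Context: All graphs are finite, simple and undirected. For a graph $G$ without isolated vertices, the inflated graph $G_I$ is obtained as follows: each vertex $x_i$ of $G$ of degree $d(x_i)$ is replaced by a clique $X_i\cong K_{d(x_i)}$ whose vertices are labelled $x_ix_j$, one for each neighbour $x_j$ of $x_i$; and each edge $x_ix_j$ of $G$ is replaced by the edge joining $x_ix_j\in X_i$ to $x_jx_i\in X_j$. A set $S\subseteq V(H)$ is a $k$-tuple total dominating set of a graph $H$ if every vertex of $H$ has at least $k$ neighbours in $S$; $\gamma_{\times k,t}(H)$ denotes the minimum cardinality of such a set. A subgraph of $G$ is Hamiltonian if it contains a cycle through all of its vertices. A Hamiltonian-like decomposition of $G$ is a family of pairwise vertex-disjoint Hamiltonian subgraphs $G_1,\dots,G_t$ with $V(G)=V(G_1)\cup\dots\cup V(G_t)$. For $r\geq1$, $G$ is an $r$-Hamiltonian-like decomposable graph (rHLD-graph) if there are $r$ Hamiltonian-like decompositions $G_1^{(i)},\dots,G_{t_i}^{(i)}$ ($1\leq i\leq r$) of $G$ with chosen Hamiltonian cycles $C_s^{(i)}$ of $G_s^{(i)}$ such that the cycles of any two distinct subgraphs $G_s^{(i)}$, $G_r^{(j)}$ share no edge. An rHLD-graph $G$ of order $n$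 is an rHLPM-graph if, for such a family of $r$ decompositions, $G$ has a perfect matching $M$ with $M\cap E(C_s^{(i)})=\emptyset$ for all $i,s$. For $r=0$, a 0HLPM-graph is a graph with a perfect matching (no decompositions required). -}

module Defs where

open import Data.Nat using (ℕ; _≤_)
open import Data.Fin using (Fin)
open import Data.List using (List; []; _∷_; length)
open import Data.List.Membership.Propositional using (_∈_)
open import Data.List.Relation.Unary.All using (All)
open import Data.List.Relation.Unary.Any using (Any)
open import Data.List.Relation.Unary.AllPairs using (AllPairs)
open import Data.List.Relation.Unary.Unique.Propositional using (Unique)
open import Data.Product using (Σ; ∃; _×_; _,_; proj₁; proj₂)
open import Data.Sum using (_⊎_; inj₁; inj₂)
open import Data.Unit using (⊤)
open import Data.Empty using (⊥)
open import Relation.Nullary using (¬_)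
open import Relation.Binary.PropositionalEquality using (_≡_; _≢_)

record Graph : Set₁ where
  field
    V     : Set
    _~_   : V → V → Set
    sym   : ∀ {x y} → x ~ y → y ~ x
    irrefl : ∀ {x} → ¬ (x ~ x)

open Graph public using (V; irrefl)

Kadj : ∀ {p} → Fin p ⊎ Fin p → Fin p ⊎ Fin p → Set
Kadj (inj₁ _) (inj₁ _) = ⊥
Kadj (inj₁ _) (inj₂ _) = ⊤
Kadj (inj₂ _) (inj₁ _) = ⊤
Kadj (inj₂ _) (inj₂ _) = ⊥

Ksym : ∀ {p} {x y : Fin p ⊎ Fin p} → Kadj x y → Kadj y x
Ksym {x = inj₁ _} {inj₂ _} t = t
Ksym {x = inj₂ _} {inj₁ _} t = t

Kirr : ∀ {p} {x : Fin p ⊎ Fin p} → ¬ Kadj x x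
Kirr {x = inj₁ _} ()
Kirr {x = inj₂ _} ()

K : ℕ → Graph
K p = record { V = Fin p ⊎ Fin p ; _~_ = Kadj ; sym = Ksym ; irrefl = Kirr }

-- Vertex x_i x_j is the pair (x_i , x_j) with x_i ~ x_j
-- (it lies in the clique X_i).

Dart : Graph → Set
Dart G = Σ (V G × V G) (λ xy → Graph._~_ G (proj₁ xy) (proj₂ xy))

module _ (G : Graph) where
  private
    W = Dart G

  IAdj : W → W → Set
  IAdj ((x , y) , _) ((x' , y') , _) = (x ≡ x' × y ≢ y') ⊎ (x ≡ y' × y ≡ x')

  ISym : ∀ {a b} → IAdj a b → IAdj b a
  ISym (inj₁ (Relation.Binary.PropositionalEquality.refl , ne)) =
    inj₁ (Relation.Binary.PropositionalEquality.refl ,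
          λ e → ne (Relation.Binary.PropositionalEquality.sym e))
  ISym (inj₂ (Relation.Binary.PropositionalEquality.refl , Relation.Binary.PropositionalEquality.refl)) =
    inj₂ (Relation.Binary.PropositionalEquality.refl , Relation.Binary.PropositionalEquality.refl)

  IIrr : ∀ {a} → ¬ IAdj a a
  IIrr (inj₁ (_ , ne)) = ne Relation.Binary.PropositionalEquality.refl
  IIrr {(x , y) , a} (inj₂ (Relation.Binary.PropositionalEquality.refl , _)) = irrefl G a

inflate : Graph → Graph
inflate G = record
  { V = Dart G
  ; _~_ = IAdj G ; sym = λ {a} {b} → ISym G {a} {b} ; irrefl = λ {a} → IIrr G {a} }

-- k-tuple total domination.  A vertex set is a duplicate-free list; its
-- cardinality is its length.

module _ (G : Graph) where
  open Graph G renaming (V to VG)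

  HasKNeighboursIn : ℕ → List VG → VG → Set
  HasKNeighboursIn k S v =
    ∃ λ (L : List VG) → Unique L × length L ≡ k × All (_∈ S) L × All (v ~_) L

  IsKTupleTDS : ℕ → List VG → Set
  IsKTupleTDS k S = Unique S × (∀ v → HasKNeighboursIn k S v)

  KTupleTDNumberIs : ℕ → ℕ → Set
  KTupleTDNumberIs k n =
    (∃ λ S → IsKTupleTDS k S × length S ≡ n) ×
    (∀ S → IsKTupleTDS k S → n ≤ length S)

-- Cycles.  A cycle is given by its cyclic vertex sequence [v₁,…,vₘ]
-- (m ≥ 3, distinct vertices); its edges are v₁v₂,…,vₘ₋₁vₘ,vₘv₁.

module _ {A : Set} where
  private
    go : A → List A → List (A × A)
    go f []           = []
    go f (y ∷ [])     = (y , f) ∷ []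
    go f (y ∷ z ∷ zs) = (y , z) ∷ go f (z ∷ zs)

  cycEdges : List A → List (A × A)
  cycEdges []       = []
  cycEdges (x ∷ xs) = go x (x ∷ xs)

  EdgeOf : List A → A → A → Set
  EdgeOf C u v = ((u , v) ∈ cycEdges C) ⊎ ((v , u) ∈ cycEdges C)

  NoCommonEdge : List A → List A → Set
  NoCommonEdge C C' = ∀ u v → EdgeOf C u v → EdgeOf C' u v → ⊥

  VertexDisjoint : List A → List A → Set
  VertexDisjoint C C' = ∀ v → v ∈ C → v ∈ C' → ⊥

module _ (G : Graph) where
  open Graph G renaming (V to VG)

  IsCycle : List VG → Set
  IsCycle C = Unique C × 3 ≤ length C × All (λ { (u , v) → u ~ v }) (cycEdges C)

  -- A Hamiltonian subgraph of G together with its chosen Hamiltonian cycle is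
  -- represented by that cycle C (its vertex set is the set of vertices of C).
  IsHLDecomposition : List (List VG) → Set
  IsHLDecomposition D =
    All IsCycle D × AllPairs VertexDisjoint D × (∀ v → Any (v ∈_) D)

  IsRHLDFamily : (r : ℕ) → (Fin r → List (List VG)) → Set
  IsRHLDFamily r Ds =
    (∀ i → IsHLDecomposition (Ds i)) ×
    (∀ i → AllPairs NoCommonEdge (Ds i)) ×
    (∀ i j → i ≢ j → ∀ C C' → C ∈ Ds i → C' ∈ Ds j → NoCommonEdge C C')

  IsRHLD : ℕ → Set
  IsRHLD r = ∃ λ (Ds : Fin r → List (List VG)) → IsRHLDFamily r Ds

  IsPerfectMatching : (VG → VG → Set) → Set
  IsPerfectMatching M =
    (∀ {u v} → M u v → u ~ v) × (∀ {u v} → M u v → M v u) ×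
    (∀ u → ∃ λ v → M u v × (∀ w → M u w → w ≡ v))

  -- rHLPM-graph (for r = 0 this is just: G has a perfect matching)
  IsRHLPM : ℕ → Set₁
  IsRHLPM r = ∃ λ (Ds : Fin r → List (List VG)) → IsRHLDFamily r Ds ×
    ∃ λ (M : VG → VG → Set) → IsPerfectMatching M ×
      (∀ i C → C ∈ Ds i → ∀ u v → M u v → EdgeOf C u v → ⊥)

-- Name the vertices a_x, b_y (x, y ∈ ℤ/p) and give the edge a_x b_y the difference
-- y - x.  The edges of one difference form a perfect matching.  For d + 1 < p the
-- closed walk a₀ b₀ a₁ b₁ … with b_t = a_t + d + 1 is a Hamiltonian cycle using
-- exactly the differences d and d + 1.  The cycles for d = 2i, i < r, use the
-- disjoint bands {2i, 2i + 1}, so they are edge-disjoint: an rHLD-family when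
-- 2r ≤ p; when 2r < p they also avoid difference p - 1, whose matching makes G an
-- rHLPM-graph.  (These constructions do not need the parity of p.)
-- Domination is proved for inflated graphs in general: a vertex (dart) of G_I has
-- a single neighbour outside its clique, its twin, so for k ≥ 2 a k-tuple total
-- dominating set meets every clique in at least k vertices; conversely the darts
-- of a k-factor of G form such a set with exactly k vertices per clique, and for
-- k ≤ p the union of k difference matchings is a k-factor of K_{p,p}.
module Submission where

open import Defs
open import Data.Nat using (ℕ; zero; suc; _+_; _*_; _∸_; _≤_; _<_; z≤n; s≤s; z<s; NonZero; ⌊_/2⌋)
open import Data.Nat.Properties
open import Data.Nat.DivMod
open import Data.Fin as Fin using (Fin; toℕ)
open import Data.Fin.Properties using (toℕ-fromℕ<; toℕ-injective; toℕ<n)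
open import Data.Product using (Σ; ∃; _×_; _,_; proj₁; proj₂)
open import Data.Sum using (_⊎_; inj₁; inj₂)
open import Data.Sum.Properties using (≡-dec; inj₁-injective; inj₂-injective)
open import Data.Unit using (tt)
open import Function using (id)
open import Data.Empty using (⊥; ⊥-elim)
open import Data.List using (List; []; _∷_; length; _++_; map; concatMap; filter; tabulate; allFin; drop)
open import Data.List.Properties using (length-++; length-map; length-tabulate; filter-all)
open import Data.List.Membership.Propositional using (_∈_)
open import Data.List.Membership.Propositional.Properties
  using (∈-++⁻; ∈-++⁺ˡ; ∈-++⁺ʳ; ∈-concatMap⁺; ∈-map⁺; ∈-map⁻; ∈-allFin;
         ∈-tabulate⁺; ∈-tabulate⁻)
import Data.List.Membership.DecPropositional as DecMembership
open import Data.List.Relation.Unary.All as All using (All; []; _∷_)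
import Data.List.Relation.Unary.All.Properties as All
open import Data.List.Relation.Unary.Any as Any using (here; there)
open import Data.List.Relation.Unary.AllPairs using ([]; _∷_)
open import Data.List.Relation.Unary.Unique.Propositional using (Unique)
import Data.List.Relation.Unary.Unique.Propositional.Properties as Unique
open import Data.Nat.Divisibility using (_∣_)
open import Relation.Nullary using (¬_; Dec; yes; no)
open import Relation.Binary.Definitions using (DecidableEquality)
open import Relation.Binary.PropositionalEquality

module Removal {A : Set} where

  remove : ∀ {x} (ys : List A) → x ∈ ys → List A
  remove (_ ∷ ys) (here _)  = ys
  remove (y ∷ ys) (there m) = y ∷ remove ys m

  length-remove : ∀ {x} (ys : List A) (m : x ∈ ys) → length ys ≡ suc (length (remove ys m))
  length-remove (_ ∷ ys) (here _)  = refl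
  length-remove (y ∷ ys) (there m) = cong suc (length-remove ys m)

  All-remove : ∀ {P : A → Set} {x} {ys : List A} (m : x ∈ ys) → All P ys → All P (remove ys m)
  All-remove (here _)  (_ ∷ pys)  = pys
  All-remove (there m) (py ∷ pys) = py ∷ All-remove m pys

  ∈-remove : ∀ {x z} {ys : List A} (m : x ∈ ys) → z ∈ ys → z ≢ x → z ∈ remove ys m
  ∈-remove (here refl) (here refl) z≢x = ⊥-elim (z≢x refl)
  ∈-remove (here refl) (there z∈)  _   = z∈
  ∈-remove (there m)   (here refl) _   = here refl
  ∈-remove (there m)   (there z∈)  z≢x = there (∈-remove m z∈ z≢x)

  unique-remove : ∀ {x} {ys : List A} (m : x ∈ ys) → Unique ys → Unique (remove ys m)
  unique-remove (here _)  (_ ∷ u)   = u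
  unique-remove (there m) (y∉ ∷ u) = All-remove m y∉ ∷ unique-remove m u

  remove-≢ : ∀ {x} {ys : List A} (m : x ∈ ys) → Unique ys → All (_≢ x) (remove ys m)
  remove-≢ (here refl) (x∉ ∷ _) = All.map (λ x≢y y≡x → x≢y (sym y≡x)) x∉
  remove-≢ (there m)   (y∉ ∷ u) = All.lookup y∉ m ∷ remove-≢ m u

  unique-⊆-length : ∀ {xs ys : List A} → Unique xs → All (_∈ ys) xs → length xs ≤ length ys
  unique-⊆-length {[]}     _          _          = z≤n
  unique-⊆-length {x ∷ xs} {ys} (x∉ ∷ u) (m ∷ ms) =
    subst (suc (length xs) ≤_) (sym (length-remove ys m))
      (s≤s (unique-⊆-length u (All.zipWith survives (ms , x∉))))
    where
      survives : ∀ {z} → z ∈ ys × x ≢ z → z ∈ remove ys m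
      survives (z∈ , x≢z) = ∈-remove m z∈ (λ z≡x → x≢z (sym z≡x))

open Removal

module Blocks {A B : Set} (block : A → List B) where

  All-concatMap : ∀ {P : B → Set} → (∀ x → All P (block x)) → ∀ xs → All P (concatMap block xs)
  All-concatMap h []       = []
  All-concatMap h (x ∷ xs) = All.++⁺ (h x) (All-concatMap h xs)

  length-concatMap : ∀ {k} → (∀ x → length (block x) ≡ k) →
                     ∀ xs → length (concatMap block xs) ≡ length xs * k
  length-concatMap h []       = refl
  length-concatMap h (x ∷ xs) = trans (length-++ (block x)) (cong₂ _+_ (h x) (length-concatMap h xs))

  length-concatMap-≥ : ∀ {k} → (∀ x → k ≤ length (block x)) →
                       ∀ xs → length xs * k ≤ length (concatMap block xs)
  length-concatMap-≥ h []       = z≤n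
  length-concatMap-≥ h (x ∷ xs) =
    subst (_ ≤_) (sym (length-++ (block x))) (+-mono-≤ (h x) (length-concatMap-≥ h xs))

  -- Blocks whose entries are labelled by their index are pairwise disjoint, so
  -- concatenating duplicate-free blocks over distinct indices is duplicate-free.
  module _ (label : B → A) (labelled : ∀ x → All (λ b → label b ≡ x) (block x)) where

    label-∈ : ∀ xs {b} → b ∈ concatMap block xs → label b ∈ xs
    label-∈ (x ∷ xs) b∈ with ∈-++⁻ (block x) b∈
    ... | inj₁ b∈x  = here (All.lookup (labelled x) b∈x)
    ... | inj₂ b∈xs = there (label-∈ xs b∈xs)

    unique-concatMap : (∀ x → Unique (block x)) → ∀ xs → Unique xs → Unique (concatMap block xs)
    unique-concatMap u []       _          = []
    unique-concatMap u (x ∷ xs) (x∉ ∷ uxs) = Unique.++⁺ (u x) (unique-concatMap u xs uxs) disjoint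
      where
        disjoint : ∀ {b} → b ∈ block x × b ∈ concatMap block xs → ⊥
        disjoint (b∈x , b∈xs) =
          All.lookup x∉ (subst (_∈ xs) (All.lookup (labelled x) b∈x) (label-∈ xs b∈xs)) refl

open Blocks

-- A vertex of G_I is a dart (x , y), lying in
-- the clique X_x of its owner x; its twin (y , x) is its only neighbour outside X_x.
module Inflation (G : Graph) (_≟_ : DecidableEquality (V G))
                 (~-irrelevant : ∀ {x y} (a b : Graph._~_ G x y) → a ≡ b) where

  open Graph G using (_~_) renaming (sym to ~-sym)

  owner target : Dart G → V G
  owner  ((x , _) , _) = x
  target ((_ , y) , _) = y

  twin : Dart G → Dart G
  twin ((x , y) , a) = (y , x) , ~-sym a

  -- a dart is determined by its ends, adjacency proofs being irrelevant
  dart-≡ : ∀ {d e : Dart G} → owner d ≡ owner e → target d ≡ target e → d ≡ e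
  dart-≡ {(x , y) , a} {(.x , .y) , b} refl refl = cong ((x , y) ,_) (~-irrelevant a b)

  clique-adjacent : ∀ {d e : Dart G} → owner d ≡ owner e → d ≢ e → IAdj G d e
  clique-adjacent {(x , y) , _} {(x' , y') , _} x≡x' d≢e =
    inj₁ (x≡x' , λ y≡y' → d≢e (dart-≡ x≡x' y≡y'))

  twin-adjacent : ∀ (d : Dart G) → IAdj G d (twin d)
  twin-adjacent _ = inj₂ (refl , refl)

  twin-outside : ∀ (d : Dart G) → owner (twin d) ≢ owner d
  twin-outside ((x , y) , a) y≡x = irrefl G (subst (x ~_) y≡x a)

  outside-neighbour-is-twin : ∀ {d e : Dart G} → IAdj G d e → owner e ≢ owner d → e ≡ twin d
  outside-neighbour-is-twin (inj₁ (x≡x' , _)) out = ⊥-elim (out (sym x≡x'))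
  outside-neighbour-is-twin (inj₂ (x≡y' , y≡x')) _ = dart-≡ (sym y≡x') (sym x≡y')

  inClique? : ∀ x (e : Dart G) → Dec (owner e ≡ x)
  inClique? x e = owner e ≟ x

  _≟D_ : DecidableEquality (Dart G)
  d ≟D e with owner d ≟ owner e | target d ≟ target e
  ... | yes o | yes t = yes (dart-≡ o t)
  ... | no  o | _     = no (λ d≡e → o (cong owner d≡e))
  ... | _     | no  t = no (λ d≡e → t (cong target d≡e))

  at-most-one-outside : ∀ (d : Dart G) (L : List (Dart G)) → Unique L → All (IAdj G d) L →
                        length L ≤ suc (length (filter (inClique? (owner d)) L))
  at-most-one-outside d []      _          _          = z≤n
  at-most-one-outside d (e ∷ L) (e∉ ∷ u) (de ∷ dL) with inClique? (owner d) e
  ... | yes _   = s≤s (at-most-one-outside d L u dL)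
  ... | no  out = s≤s (≤-reflexive (cong length (sym (filter-all (inClique? (owner d)) rest-inside))))
    where
      inside : ∀ {e'} → e ≢ e' × IAdj G d e' → owner e' ≡ owner d
      inside {e'} (e≢e' , de') with inClique? (owner d) e'
      ... | yes in' = in'
      ... | no out' = ⊥-elim (e≢e' (trans (outside-neighbour-is-twin {d} {e} de out)
                                          (sym (outside-neighbour-is-twin {d} {e'} de' out'))))
      rest-inside : All (λ e' → owner e' ≡ owner d) L
      rest-inside = All.zipWith inside (e∉ , dL)

  record CliquePart (S : List (Dart G)) (x : V G) : Set where
    field
      members : List (Dart G)
      unique  : Unique members
      in-S    : All (_∈ S) members
      owned   : All (λ e → owner e ≡ x) members

  module LowerBound (k : ℕ) (S : List (Dart G)) (dominating : IsKTupleTDS (inflate G) k S) where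
    open CliquePart

    inner-neighbours : ∀ d → Σ (CliquePart S (owner d)) λ P →
                       All (_≢ d) (members P) × k ≤ suc (length (members P))
    inner-neighbours d with proj₂ dominating d
    ... | L , u , len , L⊆S , adj =
      record { members = filter (inClique? (owner d)) L
             ; unique  = Unique.filter⁺ (inClique? (owner d)) u
             ; in-S    = All.filter⁺ (inClique? (owner d)) L⊆S
             ; owned   = All.all-filter (inClique? (owner d)) L } ,
      All.map (λ de e≡d → IIrr G {d} (subst (IAdj G d) e≡d de)) (All.filter⁺ (inClique? (owner d)) adj) ,
      subst (_≤ _) len (at-most-one-outside d L u adj)

    -- Take a member w of S in X_x (one exists as k ≥ 2); w together with its
    -- k - 1 inner S-neighbours gives k members of S in X_x.
    clique-share : 2 ≤ k → ∀ {x y} → x ~ y → Σ (CliquePart S x) λ P → k ≤ length (members P)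
    clique-share 2≤k {x} {y} a with inner-neighbours ((x , y) , a)
    ... | P , _ , k≤ with members P | in-S P | owned P | ≤-trans 2≤k k≤
    ...   | []    | []      | []      | s≤s ()
    ...   | w ∷ _ | w∈S ∷ _ | w∈X ∷ _ | _ with inner-neighbours w
    ...     | Q , Q≢w , k≤' =
      record { members = w ∷ members Q
             ; unique  = All.map (λ e≢w w≡e → e≢w (sym w≡e)) Q≢w ∷ unique Q
             ; in-S    = w∈S ∷ in-S Q
             ; owned   = w∈X ∷ All.map (λ e∈X → trans e∈X w∈X) (owned Q) } ,
      k≤'

    lower-bound : 2 ≤ k → (∀ x → ∃ (x ~_)) → ∀ vs → Unique vs → length vs * k ≤ length S
    lower-bound 2≤k nonisolated vs vs-unique =
      ≤-trans (length-concatMap-≥ block (λ x → proj₂ (share x)) vs)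
              (unique-⊆-length
                (unique-concatMap block owner (λ x → owned (part x)) (λ x → unique (part x)) vs vs-unique)
                (All-concatMap block (λ x → in-S (part x)) vs))
      where
        share : ∀ x → Σ (CliquePart S x) λ P → k ≤ length (members P)
        share x = clique-share 2≤k (proj₂ (nonisolated x))
        part : ∀ x → CliquePart S x
        part x = proj₁ (share x)
        block : V G → List (Dart G)
        block x = members (part x)

  -- A k-factor of G, given by its darts: at every vertex x a duplicate-free list
  -- of k darts owned by x, closed under taking twins.
  record Factor (k : ℕ) : Set where
    field
      darts       : V G → List (Dart G)
      unique      : ∀ x → Unique (darts x)
      owned       : ∀ x → All (λ d → owner d ≡ x) (darts x)
      degree      : ∀ x → length (darts x) ≡ k
      twin-closed : ∀ {x d} → d ∈ darts x → twin d ∈ darts (target d)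

  module UpperBound {k : ℕ} (F : Factor k) (vs : List (V G)) (complete : ∀ x → x ∈ vs) where
    open Factor F
    open DecMembership _≟D_ using (_∈?_)

    S : List (Dart G)
    S = concatMap darts vs

    darts-⊆-S : ∀ x → All (_∈ S) (darts x)
    darts-⊆-S x = All.tabulate λ d∈ →
      ∈-concatMap⁺ darts (Any.map (λ x≡z → subst (λ z → _ ∈ darts z) x≡z d∈) (complete x))

    -- A factor dart is dominated by its twin and the other k - 1 factor darts of
    -- its clique; any other dart by the k factor darts of its clique.
    dominated : ∀ d → HasKNeighboursIn (inflate G) k S d
    dominated d with d ∈? darts (owner d)
    ... | yes d∈ = twin d ∷ rest , twin∉rest ∷ unique-remove d∈ (unique x) ,
                   trans (sym (length-remove (darts x) d∈)) (degree x) ,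
                   All.lookup (darts-⊆-S (target d)) (twin-closed d∈) ∷ All-remove d∈ (darts-⊆-S x) ,
                   twin-adjacent d ∷ All.zipWith adjacent (All-remove d∈ (owned x) , remove-≢ d∈ (unique x))
      where
        x : V G
        x = owner d
        rest : List (Dart G)
        rest = remove (darts x) d∈
        twin∉rest : All (twin d ≢_) rest
        twin∉rest = All.map (λ e∈X t≡e → twin-outside d (trans (cong owner t≡e) e∈X))
                            (All-remove d∈ (owned x))
        adjacent : ∀ {e} → owner e ≡ x × e ≢ d → IAdj G d e
        adjacent (e∈X , e≢d) = clique-adjacent (sym e∈X) (λ d≡e → e≢d (sym d≡e))
    ... | no d∉ = darts x , unique x , degree x , darts-⊆-S x , All.tabulate adjacent
      where
        x : V G
        x = owner d
        adjacent : ∀ {e} → e ∈ darts x → IAdj G d e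
        adjacent e∈ = clique-adjacent (sym (All.lookup (owned x) e∈))
                                      (λ d≡e → d∉ (subst (_∈ darts x) (sym d≡e) e∈))

    factor-TDS : Unique vs → IsKTupleTDS (inflate G) k S
    factor-TDS vs-unique = unique-concatMap darts owner owned unique vs vs-unique , dominated

    factor-size : length S ≡ length vs * k
    factor-size = length-concatMap darts degree vs

module Cyclic (p : ℕ) .{{_ : NonZero p}} where
  open ≡-Reasoning

  %-absorbˡ : ∀ m n → (m % p + n) % p ≡ (m + n) % p
  %-absorbˡ m n = begin
    (m % p + n) % p         ≡⟨ %-distribˡ-+ (m % p) n p ⟩
    (m % p % p + n % p) % p ≡⟨ cong (λ z → (z + n % p) % p) (m%n%n≡m%n m p) ⟩
    (m % p + n % p) % p     ≡⟨ %-distribˡ-+ m n p ⟨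
    (m + n) % p             ∎

  %-absorbʳ : ∀ m n → (m + n % p) % p ≡ (m + n) % p
  %-absorbʳ m n = begin
    (m + n % p) % p ≡⟨ cong (_% p) (+-comm m (n % p)) ⟩
    (n % p + m) % p ≡⟨ %-absorbˡ n m ⟩
    (n + m) % p     ≡⟨ cong (_% p) (+-comm n m) ⟩
    (m + n) % p     ∎

  %-unshift : ∀ m c → (m + c + (p ∸ c % p)) % p ≡ m % p
  %-unshift m c = begin
    (m + c + (p ∸ c % p)) % p             ≡⟨ %-absorbˡ (m + c) _ ⟨
    ((m + c) % p + (p ∸ c % p)) % p       ≡⟨ cong (λ z → (z + (p ∸ c % p)) % p) (%-absorbʳ m c) ⟨
    ((m + c % p) % p + (p ∸ c % p)) % p   ≡⟨ %-absorbˡ (m + c % p) _ ⟩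
    (m + c % p + (p ∸ c % p)) % p         ≡⟨ cong (_% p) (+-assoc m (c % p) _) ⟩
    (m + (c % p + (p ∸ c % p))) % p       ≡⟨ cong (λ z → (m + z) % p) (m+[n∸m]≡n (m%n≤n c p)) ⟩
    (m + p) % p                           ≡⟨ [m+n]%n≡m%n m p ⟩
    m % p                                 ∎

  +-cancelʳ-% : ∀ {a b} c → a < p → b < p → (a + c) % p ≡ (b + c) % p → a ≡ b
  +-cancelʳ-% {a} {b} c a<p b<p eq = begin
    a                                ≡⟨ m<n⇒m%n≡m a<p ⟨
    a % p                            ≡⟨ %-unshift a c ⟨
    (a + c + (p ∸ c % p)) % p        ≡⟨ %-absorbˡ (a + c) _ ⟨
    ((a + c) % p + (p ∸ c % p)) % p  ≡⟨ cong (λ z → (z + (p ∸ c % p)) % p) eq ⟩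
    ((b + c) % p + (p ∸ c % p)) % p  ≡⟨ %-absorbˡ (b + c) _ ⟩
    (b + c + (p ∸ c % p)) % p        ≡⟨ %-unshift b c ⟩
    b % p                            ≡⟨ m<n⇒m%n≡m b<p ⟩
    b                                ∎

  infixl 6 _⊕_
  _⊕_ : Fin p → ℕ → Fin p
  x ⊕ c = (toℕ x + c) mod p

  toℕ-⊕ : ∀ x c → toℕ (x ⊕ c) ≡ (toℕ x + c) % p
  toℕ-⊕ x c = toℕ-fromℕ< _

  ⊕-assoc : ∀ x c d → x ⊕ c ⊕ d ≡ x ⊕ (c + d)
  ⊕-assoc x c d = toℕ-injective (begin
    toℕ (x ⊕ c ⊕ d)           ≡⟨ toℕ-⊕ (x ⊕ c) d ⟩
    (toℕ (x ⊕ c) + d) % p     ≡⟨ cong (λ z → (z + d) % p) (toℕ-⊕ x c) ⟩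
    ((toℕ x + c) % p + d) % p ≡⟨ %-absorbˡ (toℕ x + c) d ⟩
    (toℕ x + c + d) % p       ≡⟨ cong (_% p) (+-assoc (toℕ x) c d) ⟩
    (toℕ x + (c + d)) % p     ≡⟨ toℕ-⊕ x (c + d) ⟨
    toℕ (x ⊕ (c + d))         ∎)

  ⊕-period : ∀ x → x ⊕ p ≡ x
  ⊕-period x = toℕ-injective
    (trans (toℕ-⊕ x p) (trans ([m+n]%n≡m%n (toℕ x) p) (m<n⇒m%n≡m (toℕ<n x))))

  ⊕-cancelˡ : ∀ {x y} c → x ⊕ c ≡ y ⊕ c → x ≡ y
  ⊕-cancelˡ {x} {y} c eq = toℕ-injective (+-cancelʳ-% c (toℕ<n x) (toℕ<n y)
    (trans (sym (toℕ-⊕ x c)) (trans (cong toℕ eq) (toℕ-⊕ y c))))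

  ⊕-cancelʳ : ∀ x {c c'} → c < p → c' < p → x ⊕ c ≡ x ⊕ c' → c ≡ c'
  ⊕-cancelʳ x {c} {c'} c<p c'<p eq = +-cancelʳ-% (toℕ x) c<p c'<p (begin
    (c + toℕ x) % p  ≡⟨ cong (_% p) (+-comm c (toℕ x)) ⟩
    (toℕ x + c) % p  ≡⟨ toℕ-⊕ x c ⟨
    toℕ (x ⊕ c)      ≡⟨ cong toℕ eq ⟩
    toℕ (x ⊕ c')     ≡⟨ toℕ-⊕ x c' ⟩
    (toℕ x + c') % p ≡⟨ cong (_% p) (+-comm (toℕ x) c') ⟩
    (c' + toℕ x) % p ∎)

  ⟦_⟧ : ℕ → Fin p
  ⟦ t ⟧ = t mod p

  ⟦⟧-⊕ : ∀ t c → ⟦ t ⟧ ⊕ c ≡ ⟦ t + c ⟧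
  ⟦⟧-⊕ t c = toℕ-injective (trans (toℕ-⊕ ⟦ t ⟧ c)
    (trans (cong (λ z → (z + c) % p) (toℕ-fromℕ< _)) (trans (%-absorbˡ t c) (sym (toℕ-fromℕ< _)))))

  ⟦toℕ⟧ : ∀ x → ⟦ toℕ x ⟧ ≡ x
  ⟦toℕ⟧ x = toℕ-injective (trans (toℕ-fromℕ< _) (m<n⇒m%n≡m (toℕ<n x)))

  ⟦⟧-injective : ∀ {t t'} → t < p → t' < p → ⟦ t ⟧ ≡ ⟦ t' ⟧ → t ≡ t'
  ⟦⟧-injective {t} {t'} t<p t'<p eq = begin
    t          ≡⟨ m<n⇒m%n≡m t<p ⟨
    t % p      ≡⟨ toℕ-fromℕ< _ ⟨
    toℕ ⟦ t ⟧  ≡⟨ cong toℕ eq ⟩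
    toℕ ⟦ t' ⟧ ≡⟨ toℕ-fromℕ< _ ⟩
    t' % p     ≡⟨ m<n⇒m%n≡m t'<p ⟩
    t'         ∎

  ⟦p⟧ : ⟦ p ⟧ ≡ ⟦ 0 ⟧
  ⟦p⟧ = toℕ-injective (trans (toℕ-fromℕ< _) (trans ([m+n]%n≡m%n 0 p) (sym (toℕ-fromℕ< _))))

module Kpp (p : ℕ) .{{_ : NonZero p}} where
  open Cyclic p
  open ≡-Reasoning

  Vtx : Set
  Vtx = Fin p ⊎ Fin p

  _≟V_ : DecidableEquality Vtx
  _≟V_ = ≡-dec Fin._≟_ Fin._≟_

  Kadj-irrelevant : ∀ {u v : Vtx} (a b : Kadj u v) → a ≡ b
  Kadj-irrelevant {inj₁ _} {inj₂ _} _ _ = refl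
  Kadj-irrelevant {inj₂ _} {inj₁ _} _ _ = refl

  Dif : Vtx → Vtx → ℕ → Set
  Dif (inj₁ x) (inj₂ y) c = y ≡ x ⊕ c
  Dif (inj₂ y) (inj₁ x) c = y ≡ x ⊕ c
  Dif (inj₁ _) (inj₁ _) _ = ⊥
  Dif (inj₂ _) (inj₂ _) _ = ⊥

  Dif-sym : ∀ u v {c} → Dif u v c → Dif v u c
  Dif-sym (inj₁ _) (inj₂ _) e = e
  Dif-sym (inj₂ _) (inj₁ _) e = e

  Dif-adjacent : ∀ u v {c} → Dif u v c → Kadj u v
  Dif-adjacent (inj₁ _) (inj₂ _) _ = tt
  Dif-adjacent (inj₂ _) (inj₁ _) _ = tt

  Dif-unique : ∀ u v {c c'} → c < p → c' < p → Dif u v c → Dif u v c' → c ≡ c'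
  Dif-unique (inj₁ x) (inj₂ _) c<p c'<p e e' = ⊕-cancelʳ x c<p c'<p (trans (sym e) e')
  Dif-unique (inj₂ _) (inj₁ x) c<p c'<p e e' = ⊕-cancelʳ x c<p c'<p (trans (sym e) e')

  partner : Vtx → ℕ → Vtx
  partner (inj₁ x) c = inj₂ (x ⊕ c)
  partner (inj₂ y) c = inj₁ (y ⊕ (p ∸ c))

  partner-adjacent : ∀ u c → Kadj u (partner u c)
  partner-adjacent (inj₁ _) _ = tt
  partner-adjacent (inj₂ _) _ = tt

  Dif-partner : ∀ u {c} → c ≤ p → Dif u (partner u c) c
  Dif-partner (inj₁ _) _ = refl
  Dif-partner (inj₂ y) {c} c≤p = sym (begin
    y ⊕ (p ∸ c) ⊕ c   ≡⟨ ⊕-assoc y (p ∸ c) c ⟩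
    y ⊕ (p ∸ c + c)   ≡⟨ cong (y ⊕_) (m∸n+n≡m c≤p) ⟩
    y ⊕ p             ≡⟨ ⊕-period y ⟩
    y                 ∎)

  partner-unique : ∀ u v {c} → c ≤ p → Dif u v c → v ≡ partner u c
  partner-unique (inj₁ _) (inj₂ _) _ e = cong inj₂ e
  partner-unique (inj₂ y) (inj₁ x) {c} c≤p e = cong inj₁ (sym (begin
    y ⊕ (p ∸ c)       ≡⟨ cong (_⊕ (p ∸ c)) e ⟩
    x ⊕ c ⊕ (p ∸ c)   ≡⟨ ⊕-assoc x c (p ∸ c) ⟩
    x ⊕ (c + (p ∸ c)) ≡⟨ cong (x ⊕_) (m+[n∸m]≡n c≤p) ⟩
    x ⊕ p             ≡⟨ ⊕-period x ⟩
    x                 ∎))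

  partner-involutive : ∀ u {c} → c ≤ p → partner (partner u c) c ≡ u
  partner-involutive u {c} c≤p =
    sym (partner-unique (partner u c) u c≤p (Dif-sym u (partner u c) (Dif-partner u c≤p)))

  partner-injective : ∀ u {c c'} → c < p → c' < p → partner u c ≡ partner u c' → c ≡ c'
  partner-injective u {c} {c'} c<p c'<p eq = Dif-unique u (partner u c) c<p c'<p
    (Dif-partner u (<⇒≤ c<p)) (subst (λ v → Dif u v c') (sym eq) (Dif-partner u (<⇒≤ c'<p)))

  difference-matching : ∀ c → c ≤ p → IsPerfectMatching (K p) (λ u v → Dif u v c)
  difference-matching c c≤p =
    (λ {u} {v} → Dif-adjacent u v) , (λ {u} {v} → Dif-sym u v) ,
    λ u → partner u c , Dif-partner u c≤p , λ w → partner-unique u w c≤p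

  vertices : List Vtx
  vertices = map inj₁ (allFin p) ++ map inj₂ (allFin p)

  vertices-unique : Unique vertices
  vertices-unique = Unique.++⁺ (Unique.map⁺ inj₁-injective (Unique.allFin⁺ p))
                               (Unique.map⁺ inj₂-injective (Unique.allFin⁺ p)) disjoint
    where
      disjoint : ∀ {v} → v ∈ map inj₁ (allFin p) × v ∈ map inj₂ (allFin p) → ⊥
      disjoint (v∈A , v∈B) with ∈-map⁻ inj₁ v∈A | ∈-map⁻ inj₂ v∈B
      ... | _ , _ , refl | _ , _ , ()

  vertices-complete : ∀ v → v ∈ vertices
  vertices-complete (inj₁ x) = ∈-++⁺ˡ (∈-map⁺ inj₁ (∈-allFin x))
  vertices-complete (inj₂ y) = ∈-++⁺ʳ (map inj₁ (allFin p)) (∈-map⁺ inj₂ (∈-allFin y))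

  length-vertices : length vertices ≡ 2 * p
  length-vertices = begin
    length vertices ≡⟨ length-++ (map inj₁ (allFin p)) ⟩
    length (map inj₁ (allFin p)) + length (map inj₂ (allFin p))
      ≡⟨ cong₂ _+_ (trans (length-map inj₁ (allFin p)) (length-tabulate {n = p} id))
                   (trans (length-map inj₂ (allFin p)) (length-tabulate {n = p} id)) ⟩
    p + p ≡⟨ cong (p +_) (+-identityʳ p) ⟨
    2 * p ∎

  open Inflation (K p) _≟V_ Kadj-irrelevant

  dartAt : Vtx → ℕ → Dart (K p)
  dartAt u c = (u , partner u c) , partner-adjacent u c

  difference-factor : ∀ k → k ≤ p → Factor k
  difference-factor k k≤p = record
    { darts       = darts
    ; unique      = λ u → Unique.tabulate⁺ (λ {i} {j} eq →
                      toℕ-injective (partner-injective u (bound i) (bound j) (cong target eq)))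
    ; owned       = λ u → All.tabulate⁺ (λ _ → refl)
    ; degree      = λ u → length-tabulate _
    ; twin-closed = twin-closed }
    where
      bound : ∀ (i : Fin k) → toℕ i < p
      bound i = <-≤-trans (toℕ<n i) k≤p
      darts : Vtx → List (Dart (K p))
      darts u = tabulate (λ i → dartAt u (toℕ i))
      twin-closed : ∀ {u d} → d ∈ darts u → twin d ∈ darts (target d)
      twin-closed {u} d∈ with ∈-tabulate⁻ {f = λ i → dartAt u (toℕ i)} d∈
      ... | i , d≡ = subst (λ d → twin d ∈ darts (target d)) (sym d≡)
        (subst (_∈ darts (partner u (toℕ i)))
          (dart-≡ {dartAt (partner u (toℕ i)) (toℕ i)} {twin (dartAt u (toℕ i))}
                  refl (partner-involutive u (<⇒≤ (bound i))))
          (∈-tabulate⁺ i))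

  inflated-domination : ∀ k → 2 ≤ k → k ≤ p → KTupleTDNumberIs (inflate (K p)) k (2 * p * k)
  inflated-domination k 2≤k k≤p =
    (S , factor-TDS vertices-unique , trans factor-size size) ,
    λ S' dominating → subst (_≤ length S') size
      (LowerBound.lower-bound k S' dominating 2≤k (λ u → partner u 0 , partner-adjacent u 0)
                              vertices vertices-unique)
    where
      open UpperBound (difference-factor k k≤p) vertices vertices-complete
      size : length vertices * k ≡ 2 * p * k
      size = cong (_* k) length-vertices

module KppCycles (q : ℕ) where
  open Cyclic (suc q)
  open Kpp (suc q)
  open ≡-Reasoning

  p : ℕ
  p = suc q

  -- For suc d < p: the cycle a₀ b₀ a₁ b₁ … a_q b_q with a_t = ⟦t⟧ and
  -- b_t = ⟦t⟧ ⊕ suc d; the edges a_t b_t have difference suc d and the edges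
  -- b_t a_{t+1} (indices mod p) have difference d.
  module DifferenceCycle (d : ℕ) (sd<p : suc d < p) where

    a b : ℕ → Vtx
    a t = inj₁ ⟦ t ⟧
    b t = inj₂ (⟦ t ⟧ ⊕ suc d)

    path : ℕ → ℕ → List Vtx
    path t zero    = []
    path t (suc n) = a t ∷ b t ∷ path (suc t) n

    cycle : List Vtx
    cycle = path 0 p

    InBand : Vtx × Vtx → Set
    InBand e = ∃ λ c → (c ≡ d ⊎ c ≡ suc d) × Dif (proj₁ e) (proj₂ e) c

    ab-edge : ∀ t → InBand (a t , b t)
    ab-edge t = suc d , inj₂ refl , refl

    ba-edge : ∀ t → InBand (b t , a (suc t))
    ba-edge t = d , inj₁ refl , (begin
      ⟦ t ⟧ ⊕ suc d     ≡⟨ ⟦⟧-⊕ t (suc d) ⟩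
      ⟦ t + suc d ⟧     ≡⟨ cong ⟦_⟧ (+-suc t d) ⟩
      ⟦ suc t + d ⟧     ≡⟨ ⟦⟧-⊕ (suc t) d ⟨
      ⟦ suc t ⟧ ⊕ d     ∎)

    -- `drop 1 (cycEdges (f ∷ L))` lists the edges of the path L followed by the
    -- edge from the last vertex of L back to f; here f = a₀ = a_p.
    path-edges : ∀ n t → t + suc n ≡ p → All InBand (drop 1 (cycEdges (a 0 ∷ path t (suc n))))
    path-edges zero    t t+1≡p = ab-edge t ∷ subst (λ v → InBand (b t , v)) a[1+t]≡a₀ (ba-edge t) ∷ []
      where
        a[1+t]≡a₀ : a (suc t) ≡ a 0
        a[1+t]≡a₀ = cong inj₁ (trans (cong ⟦_⟧ (trans (+-comm 1 t) t+1≡p)) ⟦p⟧)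
    path-edges (suc n) t eq =
      ab-edge t ∷ ba-edge t ∷ path-edges n (suc t) (trans (sym (+-suc t (suc n))) eq)

    cycle-edges : All InBand (cycEdges cycle)
    cycle-edges = path-edges q 0 refl

    ∈-path⁻ : ∀ {v} t n → v ∈ path t n → ∃ λ s → t ≤ s × s < t + n × (v ≡ a s ⊎ v ≡ b s)
    ∈-path⁻ t (suc n) (here refl)         = t , ≤-refl , m<m+n t z<s , inj₁ refl
    ∈-path⁻ t (suc n) (there (here refl)) = t , ≤-refl , m<m+n t z<s , inj₂ refl
    ∈-path⁻ t (suc n) (there (there v∈)) with ∈-path⁻ (suc t) n v∈
    ... | s , t<s , s<1+t+n , v≡ = s , <⇒≤ t<s , subst (s <_) (sym (+-suc t n)) s<1+t+n , v≡

    ∈-path⁺ : ∀ t n s → t ≤ s → s < t + n → a s ∈ path t n × b s ∈ path t n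
    ∈-path⁺ t zero    s t≤s s<t+0 = ⊥-elim (<⇒≱ s<t+0 (subst (_≤ s) (sym (+-identityʳ t)) t≤s))
    ∈-path⁺ t (suc n) s t≤s s< with t ≟ s
    ... | yes refl = here refl , there (here refl)
    ... | no  t≢s with ∈-path⁺ (suc t) n s (≤∧≢⇒< t≤s t≢s) (subst (s <_) (+-suc t n) s<)
    ...   | a∈ , b∈ = there (there a∈) , there (there b∈)

    path-unique : ∀ t n → t + n ≤ p → Unique (path t n)
    path-unique t zero    _  = []
    path-unique t (suc n) le = All.tabulate a-fresh ∷ All.tabulate b-fresh ∷ path-unique (suc t) n le'
      where
        le' : suc t + n ≤ p
        le' = subst (_≤ p) (+-suc t n) le
        below : ∀ {s} → s < suc t + n → s < p
        below s< = <-≤-trans s< le'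
        t<p : t < p
        t<p = below (s≤s (m≤m+n t n))
        a-fresh : ∀ {v} → v ∈ b t ∷ path (suc t) n → a t ≢ v
        a-fresh (here refl) ()
        a-fresh (there v∈) with ∈-path⁻ (suc t) n v∈
        ... | s , t<s , s< , inj₁ refl = λ e → <⇒≢ t<s (⟦⟧-injective t<p (below s<) (inj₁-injective e))
        ... | _ , _   , _  , inj₂ refl = λ ()
        b-fresh : ∀ {v} → v ∈ path (suc t) n → b t ≢ v
        b-fresh v∈ with ∈-path⁻ (suc t) n v∈
        ... | _ , _   , _  , inj₁ refl = λ ()
        ... | s , t<s , s< , inj₂ refl =
          λ e → <⇒≢ t<s (⟦⟧-injective t<p (below s<) (⊕-cancelˡ (suc d) (inj₂-injective e)))

    length-path : ∀ t n → length (path t n) ≡ n + n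
    length-path t zero    = refl
    length-path t (suc n) = cong suc (trans (cong suc (length-path (suc t) n)) (sym (+-suc n n)))

    cycle-covers : ∀ v → v ∈ cycle
    cycle-covers (inj₁ x) =
      subst (_∈ cycle) (cong inj₁ (⟦toℕ⟧ x)) (proj₁ (∈-path⁺ 0 p (toℕ x) z≤n (toℕ<n x)))
    cycle-covers (inj₂ y) =
      subst (_∈ cycle) (cong inj₂ b-at-t) (proj₂ (∈-path⁺ 0 p (toℕ t) z≤n (toℕ<n t)))
      where
        t : Fin p
        t = y ⊕ (p ∸ suc d)
        b-at-t : ⟦ toℕ t ⟧ ⊕ suc d ≡ y
        b-at-t = begin
          ⟦ toℕ t ⟧ ⊕ suc d         ≡⟨ cong (_⊕ suc d) (⟦toℕ⟧ t) ⟩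
          y ⊕ (p ∸ suc d) ⊕ suc d   ≡⟨ ⊕-assoc y (p ∸ suc d) (suc d) ⟩
          y ⊕ (p ∸ suc d + suc d)   ≡⟨ cong (y ⊕_) (m∸n+n≡m (<⇒≤ sd<p)) ⟩
          y ⊕ p                     ≡⟨ ⊕-period y ⟩
          y                         ∎

    cycle-is-cycle : IsCycle (K p) cycle
    cycle-is-cycle =
      path-unique 0 p ≤-refl ,
      subst (3 ≤_) (sym (length-path 0 p)) (+-mono-≤ {1} (<⇒≤ 1<p) 1<p) ,
      All.map (λ {e} → band-adjacent e) cycle-edges
      where
        1<p : 1 < p
        1<p = ≤-<-trans (s≤s z≤n) sd<p
        band-adjacent : ∀ e → InBand e → Kadj (proj₁ e) (proj₂ e)
        band-adjacent (u , v) (_ , _ , dif) = Dif-adjacent u v dif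

    cycle-edge-difference : ∀ u v → EdgeOf cycle u v → InBand (u , v)
    cycle-edge-difference u v (inj₁ uv∈) = All.lookup cycle-edges uv∈
    cycle-edge-difference u v (inj₂ vu∈) with All.lookup cycle-edges vu∈
    ... | c , band , dif = c , band , Dif-sym v u dif

  -- The i-th cycle of a family uses the band of differences {2i, 2i+1}; since
  -- ⌊c/2⌋ = i on band i, cycles with distinct indices share no edge.
  band-index : ∀ i {c} → c ≡ i + i ⊎ c ≡ suc (i + i) → ⌊ c /2⌋ ≡ i
  band-index i (inj₁ refl) = sym (n≡⌊n+n/2⌋ i)
  band-index i (inj₂ refl) = sym (n≡⌈n+n/2⌉ i)

  band-bound : ∀ i {c} → c ≡ i + i ⊎ c ≡ suc (i + i) → c ≤ suc (i + i)
  band-bound i (inj₁ refl) = n≤1+n (i + i)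
  band-bound i (inj₂ refl) = ≤-refl

  module Family (r : ℕ) (fits : ∀ (i : Fin r) → suc (toℕ i + toℕ i) < p) where
    module C (i : Fin r) = DifferenceCycle (toℕ i + toℕ i) (fits i)

    decompositions : Fin r → List (List Vtx)
    decompositions i = C.cycle i ∷ []

    edge-band : ∀ i {C} → C ∈ decompositions i → ∀ u v → EdgeOf C u v →
                ∃ λ c → c ≤ suc (toℕ i + toℕ i) × ⌊ c /2⌋ ≡ toℕ i × Dif u v c
    edge-band i (here refl) u v uv with C.cycle-edge-difference i u v uv
    ... | c , band , dif = c , band-bound (toℕ i) band , band-index (toℕ i) band , dif

    family : IsRHLDFamily (K p) r decompositions
    family = (λ i → (C.cycle-is-cycle i ∷ []) , ([] ∷ []) , (λ v → here (C.cycle-covers i v))) ,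
             (λ i → [] ∷ []) ,
             edge-disjoint
      where
        edge-disjoint : ∀ i j → i ≢ j → ∀ C C' → C ∈ decompositions i → C' ∈ decompositions j →
                        NoCommonEdge C C'
        edge-disjoint i j i≢j C C' C∈ C'∈ u v uv∈C uv∈C'
          with edge-band i C∈ u v uv∈C | edge-band j C'∈ u v uv∈C'
        ... | c , c≤ , ⌊c/2⌋≡i , dif | c' , c'≤ , ⌊c'/2⌋≡j , dif' =
          i≢j (toℕ-injective (begin
            toℕ i    ≡⟨ ⌊c/2⌋≡i ⟨
            ⌊ c /2⌋  ≡⟨ cong ⌊_/2⌋ (Dif-unique u v c<p c'<p dif dif') ⟩
            ⌊ c' /2⌋ ≡⟨ ⌊c'/2⌋≡j ⟩
            toℕ j    ∎))
          where
            c<p : c < p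
            c<p = ≤-<-trans c≤ (fits i)
            c'<p : c' < p
            c'<p = ≤-<-trans c'≤ (fits j)

  band-fits : ∀ {r n} (i : Fin r) → r + r ≤ n → suc (toℕ i + toℕ i) < n
  band-fits {r} {n} i 2r≤n =
    subst (_≤ n) (cong suc (+-suc (toℕ i) (toℕ i))) (≤-trans (+-mono-≤ i<r i<r) 2r≤n)
    where
      i<r : suc (toℕ i) ≤ r
      i<r = toℕ<n i

  hld : ∀ r → r + r ≤ p → IsRHLD (K p) r
  hld r 2r≤p = decompositions , family
    where open Family r (λ i → band-fits i 2r≤p)

  -- 2r < p: the cycles avoid difference q = p - 1, whose matching is perfect,
  -- so K_{p,p} is an rHLPM-graph
  hlpm : ∀ r → r + r < p → IsRHLPM (K p) r
  hlpm r 2r<p = decompositions , family , (λ u v → Dif u v q) , difference-matching q (n≤1+n q) , avoids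
    where
      fits-q : ∀ (i : Fin r) → suc (toℕ i + toℕ i) < q
      fits-q i = band-fits i (≤-pred 2r<p)
      open Family r (λ i → <-trans (fits-q i) (n<1+n q))
      avoids : ∀ i C → C ∈ decompositions i → ∀ u v → Dif u v q → EdgeOf C u v → ⊥
      avoids i C C∈ u v uv∈M uv∈C with edge-band i C∈ u v uv∈C
      ... | c , c≤ , _ , dif = <⇒≢ c<q (Dif-unique u v (<-trans c<q (n<1+n q)) (n<1+n q) dif uv∈M)
        where
          c<q : c < q
          c<q = ≤-<-trans c≤ (fits-q i)

half-fits : ∀ n → n / 2 + n / 2 ≤ n
half-fits n = subst (_≤ n) (trans (*-comm (n / 2) 2) (cong (n / 2 +_) (+-identityʳ (n / 2)))) (m/n*n≤m n 2)

pred-half-fits : ∀ h n → h + h ≤ n → 0 < n → (h ∸ 1) + (h ∸ 1) < n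
pred-half-fits zero    n _     0<n = 0<n
pred-half-fits (suc h) n 2h≤n  _   = <-≤-trans (s≤s (+-monoʳ-≤ h (n≤1+n h))) 2h≤n

open KppCycles using (hld; hlpm)
open Kpp using (inflated-domination)

proposition4p3 : (p k : ℕ) → 2 ≤ k → k ≤ p →
    (2 ∣ p → IsRHLPM (K p) (p / 2 ∸ 1)) ×
    (¬ (2 ∣ p) → IsRHLD (K p) (p / 2)) ×
    KTupleTDNumberIs (inflate (K p)) k (2 * p * k)
-- p = 0 contradicts 2 ≤ k ≤ p; otherwise apply hlpm with r = ⌊p/2⌋ - 1, hld
-- with r = ⌊p/2⌋, and the domination number of the inflated K_{p,p}.
proposition4p3 zero       (suc _) _   ()
proposition4p3 p@(suc q) k        2≤k k≤p =
  (λ _ → hlpm q (p / 2 ∸ 1) (pred-half-fits (p / 2) p (half-fits p) z<s)) ,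
  (λ _ → hld q (p / 2) (half-fits p)) ,
  inflated-domination p k 2≤k k≤p
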